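{- Let $(s_n)_{n\ge0}$ be Stewart's choral sequence, defined by $s_{3n}=0$, $s_{3n+1}=s_n$ for all $n\ge 0$ and $s_{3n-1}=1$ for all $n\ge1$. Then the running sum $\mathrm{sum}_{\mathrm{sc}}(n)=\sum_{i=0}^{n}s_i$ is not $3$-synchronised.
   Context: A function $f:\mathbb{N}\to\mathbb{N}$ is $3$-synchronised if there is a finite automaton which, reading the base-$3$ representations of $n$ and $m$ in parallel (most significant digit first, the shorter padded with leading zeros), accepts exactly the pairs $(n,m)$ with $m = f(n)$. -}

module Defs where

open import Data.Nat using (ℕ; zero; suc; _+_; _∸_; _⊔_)
open import Data.Nat.DivMod using (_/_; _%_)
open import Data.Fin using (Fin; fromℕ<)
open import Data.Nat.DivMod using (m%n<n)
open import Data.Bool using (Bool; true; false; if_then_else_)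
open import Data.Nat using (_≡ᵇ_)
open import Data.List using (List; []; _∷_; foldl)
open import Data.Product using (_×_; _,_)

record DFA (Σ : Set) : Set where
  field
    numStates : ℕ
    start     : Fin numStates
    step      : Fin numStates → Σ → Fin numStates
    accepting : Fin numStates → Bool

  run : List Σ → Fin numStates
  run w = foldl step start w

  accepts : List Σ → Bool
  accepts w = accepting (run w)

digit3 : ℕ → ℕ → Fin 3
digit3 zero    n = fromℕ< (m%n<n n 3)
digit3 (suc i) n = digit3 i (n / 3)

-- length of the canonical base-3 representation of n (no leading zeros;
-- 0 is represented by the empty word). The fuel n is sufficient.
private
  lenAux : ℕ → ℕ → ℕ
  lenAux zero    n = zero
  lenAux (suc f) n = if n ≡ᵇ 0 then 0 else suc (lenAux f (n / 3))

len3 : ℕ → ℕ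
len3 n = lenAux n n

encodeLen : ℕ → ℕ → ℕ → List (Fin 3 × Fin 3)
encodeLen zero    n m = []
encodeLen (suc L) n m = (digit3 L n , digit3 L m) ∷ encodeLen L n m

-- base-3 representations of n and m read in parallel, most significant digit
-- first, the shorter one padded with leading zeros
encode3 : ℕ → ℕ → List (Fin 3 × Fin 3)
encode3 n m = encodeLen (len3 n ⊔ len3 m) n m

Synchronised3 : (ℕ → ℕ) → Set
Synchronised3 f =
  Σ' (DFA (Fin 3 × Fin 3)) λ A →
    ∀ n m → (DFA.accepts A (encode3 n m) ≡ true) ⇔ (m ≡ f n)
  where
  open import Data.Product using () renaming (Σ to Σ')
  open import Relation.Binary.PropositionalEquality using (_≡_)
  open import Function.Bundles using (_⇔_)

runningSum : (ℕ → ℕ) → ℕ → ℕ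
runningSum s zero    = s 0
runningSum s (suc n) = runningSum s n + s (suc n)

{-# OPTIONS --safe #-}
-- Let R k = repunit k be the number written with k ones in base 3.  Since
-- S (3n+1) = S n + n for the running sum S, we get 2 S (R k) + k = R k.  An automaton
-- with N states synchronising S accepts the word of (R K, S (R K)) for K = 2N, and by
-- pigeonhole two of its prefixes of length at most N reach the same state.  Deleting the
-- p digit pairs in between gives an accepted word, so it encodes (R (K - p), S (R (K - p))).
-- The two pairs agree in their r ≥ N lowest digits, so reducing 2 S (R k) + k = R k
-- modulo 3^r for k = K and k = K - p gives 3^r ∣ p, impossible as 0 < p ≤ N < 3^r.
module Submission where

open import Data.Bool using (true)
open import Data.Fin using (Fin; toℕ)
open import Data.Fin.Properties using (fromℕ<-cong; pigeonhole; toℕ<n)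
open import Data.List using (List; _∷_; _++_; foldl)
open import Data.List.Properties using (foldl-++)
open import Data.Nat
open import Data.Nat.DivMod
open import Data.Nat.Divisibility using (_∣_; divides; n∣m*n; ∣m+n∣m⇒∣n; >⇒∤)
open import Data.Nat.Properties
open import Data.Nat.Solver using (module +-*-Solver)
open import Data.Product using (_×_; _,_; ∃-syntax)
open import Function.Base using (_∘_)
open import Function.Bundles using (_⇔_; Equivalence)
open import Relation.Binary.PropositionalEquality
open import Relation.Nullary using (¬_)

open import Defs

open +-*-Solver

[m+n*o]/o≡n : ∀ m n o .{{_ : NonZero o}} → m < o → (m + n * o) / o ≡ n
[m+n*o]/o≡n m n o m<o = begin
  (m + n * o) / o    ≡⟨ +-distrib-/-∣ʳ m (n∣m*n n) ⟩
  m / o + n * o / o  ≡⟨ cong₂ _+_ (m<n⇒m/n≡0 m<o) (m*n/n≡m n o) ⟩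
  n                  ∎
  where open ≡-Reasoning

[m+n*o]%o≡m : ∀ m n o .{{_ : NonZero o}} → m < o → (m + n * o) % o ≡ m
[m+n*o]%o≡m m n o m<o = trans ([m+kn]%n≡m%n m n o) (m<n⇒m%n≡m m<o)

[m+n]%o≡m%o⇒o∣n : ∀ m n o .{{_ : NonZero o}} → (m + n) % o ≡ m % o → o ∣ n
[m+n]%o≡m%o⇒o∣n m n o eq = ∣m+n∣m⇒∣n (divides ((m + n) / o) quotients) (n∣m*n (m / o))
  where
  open ≡-Reasoning
  quotients : m / o * o + n ≡ (m + n) / o * o
  quotients = +-cancelˡ-≡ (m % o) _ _ (begin
    m % o + (m / o * o + n)        ≡⟨ sym (+-assoc (m % o) _ n) ⟩
    m % o + m / o * o + n          ≡⟨ cong (_+ n) (sym (m≡m%n+[m/n]*n m o)) ⟩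
    m + n                          ≡⟨ m≡m%n+[m/n]*n (m + n) o ⟩
    (m + n) % o + (m + n) / o * o  ≡⟨ cong (_+ (m + n) / o * o) eq ⟩
    m % o + (m + n) / o * o        ∎)

m+n*o<p*o : ∀ {m n o p} → m < o → n < p → m + n * o < p * o
m+n*o<p*o {m} {n} {o} {p} m<o n<p = begin-strict
  m + n * o  <⟨ +-monoˡ-< (n * o) m<o ⟩
  o + n * o  ≤⟨ *-monoˡ-≤ o n<p ⟩
  p * o      ∎
  where open ≤-Reasoning

3^≢0 : ∀ r → NonZero (3 ^ r)
3^≢0 r = m^n≢0 3 r

infixl 7 _/3^_ _%3^_

_/3^_ : ℕ → ℕ → ℕ
x /3^ r = _/_ x (3 ^ r) {{3^≢0 r}}

_%3^_ : ℕ → ℕ → ℕ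
x %3^ r = _%_ x (3 ^ r) {{3^≢0 r}}

digit3-+ : ∀ i b x → digit3 (i + b) x ≡ digit3 i (x /3^ b)
digit3-+ i zero    x = cong₂ digit3 (+-identityʳ i) (sym (n/1≡n x))
digit3-+ i (suc b) x = begin
  digit3 (i + suc b) x    ≡⟨ cong (λ j → digit3 j x) (+-suc i b) ⟩
  digit3 (i + b) (x / 3)  ≡⟨ digit3-+ i b (x / 3) ⟩
  digit3 i (x / 3 /3^ b)  ≡⟨ cong (digit3 i) (m/n/o≡m/[n*o] x 3 (3 ^ b) {{_}} {{3^≢0 b}} {{3^≢0 (suc b)}}) ⟩
  digit3 i (x /3^ suc b)  ∎
  where open ≡-Reasoning

digit3-%3^ : ∀ r x → digit3 r (x %3^ suc r) ≡ digit3 r x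
digit3-%3^ r x = begin
  digit3 r (x %3^ suc r)        ≡⟨ digit3-+ 0 r _ ⟩
  digit3 0 (x %3^ suc r /3^ r)  ≡⟨ cong (digit3 0) (m%[n*o]/o≡m/o%n x 3 (3 ^ r) {{_}} {{3^≢0 r}} {{3^≢0 (suc r)}}) ⟩
  digit3 0 (x /3^ r % 3)        ≡⟨ fromℕ<-cong _ _ (m%n%n≡m%n (x /3^ r) 3) _ _ ⟩
  digit3 0 (x /3^ r)            ≡⟨ digit3-+ 0 r x ⟨
  digit3 r x                    ∎
  where open ≡-Reasoning

%3^-%3^ : ∀ r x → x %3^ suc r %3^ r ≡ x %3^ r
%3^-%3^ r x = m∣n⇒o%n%m≡o%m (3 ^ r) (3 ^ suc r) x {{3^≢0 r}} {{3^≢0 (suc r)}} (n∣m*n 3)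

encodeLen-+ : ∀ a b x y → encodeLen (a + b) x y ≡ encodeLen a (x /3^ b) (y /3^ b) ++ encodeLen b x y
encodeLen-+ zero    b x y = refl
encodeLen-+ (suc a) b x y = cong₂ _∷_ (cong₂ _,_ (digit3-+ a b x) (digit3-+ a b y)) (encodeLen-+ a b x y)

encodeLen-%3^ : ∀ r x y → encodeLen r (x %3^ r) (y %3^ r) ≡ encodeLen r x y
encodeLen-%3^ zero    x y = refl
encodeLen-%3^ (suc r) x y = cong₂ _∷_ (cong₂ _,_ (digit3-%3^ r x) (digit3-%3^ r y)) (begin
  encodeLen r (x %3^ suc r) (y %3^ suc r)                ≡⟨ encodeLen-%3^ r _ _ ⟨
  encodeLen r (x %3^ suc r %3^ r) (y %3^ suc r %3^ r)    ≡⟨ cong₂ (encodeLen r) (%3^-%3^ r x) (%3^-%3^ r y) ⟩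
  encodeLen r (x %3^ r) (y %3^ r)                        ≡⟨ encodeLen-%3^ r x y ⟩
  encodeLen r x y                                        ∎)
  where open ≡-Reasoning

encodeLen-cong-%3^ : ∀ r {x x′ y y′} → x %3^ r ≡ x′ %3^ r → y %3^ r ≡ y′ %3^ r →
                     encodeLen r x y ≡ encodeLen r x′ y′
encodeLen-cong-%3^ r {x} {x′} {y} {y′} x≡x′ y≡y′ = begin
  encodeLen r x y                    ≡⟨ encodeLen-%3^ r x y ⟨
  encodeLen r (x %3^ r) (y %3^ r)    ≡⟨ cong₂ (encodeLen r) x≡x′ y≡y′ ⟩
  encodeLen r (x′ %3^ r) (y′ %3^ r)  ≡⟨ encodeLen-%3^ r x′ y′ ⟩
  encodeLen r x′ y′                  ∎
  where open ≡-Reasoning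

repunit : ℕ → ℕ
repunit zero    = 0
repunit (suc k) = suc (3 * repunit k)

repunit-+ : ∀ a b → repunit (a + b) ≡ repunit b + repunit a * 3 ^ b
repunit-+ a zero    = trans (cong repunit (+-identityʳ a)) (sym (*-identityʳ (repunit a)))
repunit-+ a (suc b) = begin
  repunit (a + suc b)                          ≡⟨ cong repunit (+-suc a b) ⟩
  suc (3 * repunit (a + b))                    ≡⟨ cong (suc ∘ (3 *_)) (repunit-+ a b) ⟩
  suc (3 * (repunit b + repunit a * 3 ^ b))    ≡⟨ solve 3 (λ u v w → con 1 :+ con 3 :* (u :+ v :* w)
                                                              := con 1 :+ con 3 :* u :+ v :* (con 3 :* w))
                                                          refl (repunit b) (repunit a) (3 ^ b) ⟩
  suc (3 * repunit b) + repunit a * 3 ^ suc b  ∎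
  where open ≡-Reasoning

repunit<3^ : ∀ k → repunit k < 3 ^ k
repunit<3^ zero    = s≤s z≤n
repunit<3^ (suc k) = begin
  2 + 3 * repunit k    ≤⟨ n≤1+n _ ⟩
  3 + 3 * repunit k    ≡⟨ *-suc 3 (repunit k) ⟨
  3 * suc (repunit k)  ≤⟨ *-monoʳ-≤ 3 (repunit<3^ k) ⟩
  3 * 3 ^ k            ∎
  where open ≤-Reasoning

k≤repunit : ∀ k → k ≤ repunit k
k≤repunit zero    = z≤n
k≤repunit (suc k) = s≤s (≤-trans (k≤repunit k) (m≤n*m (repunit k) 3))

repunit-/3^ : ∀ a b → repunit (a + b) /3^ b ≡ repunit a
repunit-/3^ a b = trans (cong (_/3^ b) (repunit-+ a b))
  ([m+n*o]/o≡n (repunit b) (repunit a) (3 ^ b) {{3^≢0 b}} (repunit<3^ b))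

repunit-%3^ : ∀ a b → repunit (a + b) %3^ b ≡ repunit b
repunit-%3^ a b = trans (cong (_%3^ b) (repunit-+ a b))
  ([m+n*o]%o≡m (repunit b) (repunit a) (3 ^ b) {{3^≢0 b}} (repunit<3^ b))

twice-%3^-repunit : ∀ q r m c → 2 * m + c ≡ repunit (q + r) → (2 * (m %3^ r) + c) %3^ r ≡ repunit r
twice-%3^-repunit q r m c eq = begin
  (2 * (m %3^ r) + c) %3^ r                       ≡⟨ [m+kn]%n≡m%n _ (2 * (m /3^ r)) (3 ^ r) {{3^≢0 r}} ⟨
  (2 * (m %3^ r) + c + 2 * (m /3^ r) * 3 ^ r) %3^ r
     ≡⟨ cong (_%3^ r) (solve 4 (λ y x M c → con 2 :* y :+ c :+ con 2 :* x :* M := con 2 :* (y :+ x :* M) :+ c)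
                               refl (m %3^ r) (m /3^ r) (3 ^ r) c) ⟩
  (2 * (m %3^ r + m /3^ r * 3 ^ r) + c) %3^ r     ≡⟨ cong (λ t → (2 * t + c) %3^ r) (m≡m%n+[m/n]*n m (3 ^ r) {{3^≢0 r}}) ⟨
  (2 * m + c) %3^ r                               ≡⟨ cong (_%3^ r) eq ⟩
  repunit (q + r) %3^ r                           ≡⟨ repunit-%3^ q r ⟩
  repunit r                                       ∎
  where open ≡-Reasoning

-- `lenAux` is private to Defs; unification in `len3-suc` solves the metavariable to it.
mutual
  len3-fuel : ℕ → ℕ → ℕ
  len3-fuel = _

  len3-suc : ∀ k → len3 (suc k) ≡ suc (len3-fuel k (suc k / 3))
  len3-suc k with suc k / 3
  ... | _ = refl

len3-fuel-zero : ∀ f → len3-fuel f 0 ≡ 0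
len3-fuel-zero zero    = refl
len3-fuel-zero (suc f) = refl

[1+3n]/3≡n : ∀ n → suc (3 * n) / 3 ≡ n
[1+3n]/3≡n n = trans (cong (λ t → suc t / 3) (*-comm 3 n)) ([m+n*o]/o≡n 1 n 3 (s≤s (s≤s z≤n)))

len3-fuel-repunit : ∀ {f} k → k ≤ f → len3-fuel f (repunit k) ≡ k
len3-fuel-repunit {f}     zero    _         = len3-fuel-zero f
len3-fuel-repunit {suc f} (suc k) (s≤s k≤f) =
  cong suc (trans (cong (len3-fuel f) ([1+3n]/3≡n (repunit k))) (len3-fuel-repunit k k≤f))

len3-fuel-< : ∀ {L} f y → y < 3 ^ L → len3-fuel f y ≤ L
len3-fuel-<         zero    y       _         = z≤n
len3-fuel-<         (suc f) zero    _         = z≤n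
len3-fuel-< {zero}  (suc f) (suc y) (s≤s ())
len3-fuel-< {suc L} (suc f) (suc y) y<3^[1+L] =
  s≤s (len3-fuel-< f (suc y / 3) (m<n*o⇒m/o<n (subst (suc y <_) (*-comm 3 (3 ^ L)) y<3^[1+L])))

len3-repunit : ∀ k → len3 (repunit k) ≡ k
len3-repunit k = len3-fuel-repunit k (k≤repunit k)

len3-< : ∀ {L} y → y < 3 ^ L → len3 y ≤ L
len3-< y = len3-fuel-< y y

encode3-repunit : ∀ k y → y < 3 ^ k → encode3 (repunit k) y ≡ encodeLen k (repunit k) y
encode3-repunit k y y<3^k = cong (λ L → encodeLen L (repunit k) y) (begin
  len3 (repunit k) ⊔ len3 y  ≡⟨ cong (_⊔ len3 y) (len3-repunit k) ⟩
  k ⊔ len3 y                 ≡⟨ m≥n⇒m⊔n≡m (len3-< y y<3^k) ⟩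
  k                          ∎)
  where open ≡-Reasoning

module _ {Σ : Set} (A : DFA Σ) where
  open DFA A

  accepts-++-cong : ∀ u u′ v → run u ≡ run u′ → accepts (u ++ v) ≡ accepts (u′ ++ v)
  accepts-++-cong u u′ v same = cong accepting (begin
    foldl step start (u ++ v)   ≡⟨ foldl-++ step start u v ⟩
    foldl step (run u) v        ≡⟨ cong (λ q → foldl step q v) same ⟩
    foldl step (run u′) v       ≡⟨ foldl-++ step start u′ v ⟨
    foldl step start (u′ ++ v)  ∎)
    where open ≡-Reasoning

  run-collision : (w : ℕ → List Σ) →
                  ∃[ a ] ∃[ p ] 0 < p × a + p ≤ numStates × run (w a) ≡ run (w (a + p))
  run-collision w with pigeonhole (n<1+n numStates) (λ t → run (w (toℕ t)))
  ... | i , j , i<j , same =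
    toℕ i , toℕ j ∸ toℕ i , m<n⇒0<n∸m i<j ,
    subst (_≤ numStates) (sym i+[j∸i]≡j) (s≤s⁻¹ (toℕ<n j)) ,
    subst (λ t → run (w (toℕ i)) ≡ run (w t)) (sym i+[j∸i]≡j) same
    where
    i+[j∸i]≡j : toℕ i + (toℕ j ∸ toℕ i) ≡ toℕ j
    i+[j∸i]≡j = m+[n∸m]≡n (<⇒≤ i<j)

module _ (f : ℕ → ℕ) (2f[repunit]+k≡repunit : ∀ k → 2 * f (repunit k) + k ≡ repunit k) where

  f[repunit]<3^ : ∀ k → f (repunit k) < 3 ^ k
  f[repunit]<3^ k = begin-strict
    f (repunit k)          ≤⟨ m≤m+n _ _ ⟩
    2 * f (repunit k)      ≤⟨ m≤m+n _ k ⟩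
    2 * f (repunit k) + k  ≡⟨ 2f[repunit]+k≡repunit k ⟩
    repunit k              <⟨ repunit<3^ k ⟩
    3 ^ k                  ∎
    where open ≤-Reasoning

  prefix : ℕ → ℕ → ℕ → List (Fin 3 × Fin 3)
  prefix K c q = encodeLen c (repunit K /3^ q) (f (repunit K) /3^ q)

  module _ (A : DFA (Fin 3 × Fin 3))
           (spec : ∀ n m → (DFA.accepts A (encode3 n m) ≡ true) ⇔ (m ≡ f n)) where
    open DFA A

    -- (n′, m′) is (n, m) with the p digit pairs following the first a deleted
    module Pumped (a p r : ℕ) where
      K n m n′ m′ : ℕ
      K = a + p + r
      n = repunit K
      m = f n
      n′ = repunit (a + r)
      m′ = m %3^ r + m /3^ (p + r) * 3 ^ r

      m′%3^r≡m%3^r : m′ %3^ r ≡ m %3^ r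
      m′%3^r≡m%3^r = [m+n*o]%o≡m (m %3^ r) (m /3^ (p + r)) (3 ^ r) {{3^≢0 r}} (m%n<n m (3 ^ r) {{3^≢0 r}})

      m′<3^ : m′ < 3 ^ (a + r)
      m′<3^ = subst (m′ <_) (sym (^-distribˡ-+-* 3 a r))
        (m+n*o<p*o (m%n<n m (3 ^ r) {{3^≢0 r}}) (m<n*o⇒m/o<n {n = 3 ^ a} {{3^≢0 (p + r)}} m<3^a*3^[p+r]))
        where
        m<3^a*3^[p+r] : m < 3 ^ a * 3 ^ (p + r)
        m<3^a*3^[p+r] = subst (m <_) (trans (cong (3 ^_) (+-assoc a p r)) (^-distribˡ-+-* 3 a (p + r)))
                          (f[repunit]<3^ K)

      encode3-pumped : encode3 n′ m′ ≡ prefix K a (p + r) ++ encodeLen r n m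
      encode3-pumped = begin
        encode3 n′ m′                                            ≡⟨ encode3-repunit (a + r) m′ m′<3^ ⟩
        encodeLen (a + r) n′ m′                                  ≡⟨ encodeLen-+ a r n′ m′ ⟩
        encodeLen a (n′ /3^ r) (m′ /3^ r) ++ encodeLen r n′ m′   ≡⟨ cong₂ _++_ (cong₂ (encodeLen a) high-n high-m)
                                                                                (encodeLen-cong-%3^ r low-n m′%3^r≡m%3^r) ⟩
        prefix K a (p + r) ++ encodeLen r n m                    ∎
        where
        open ≡-Reasoning
        high-n : n′ /3^ r ≡ n /3^ (p + r)
        high-n = trans (repunit-/3^ a r)
          (sym (trans (cong (λ k → repunit k /3^ (p + r)) (+-assoc a p r)) (repunit-/3^ a (p + r))))
        high-m : m′ /3^ r ≡ m /3^ (p + r)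
        high-m = [m+n*o]/o≡n (m %3^ r) (m /3^ (p + r)) (3 ^ r) {{3^≢0 r}} (m%n<n m (3 ^ r) {{3^≢0 r}})
        low-n : n′ %3^ r ≡ n %3^ r
        low-n = trans (repunit-%3^ a r) (sym (repunit-%3^ (a + p) r))

      m′≡f[n′] : run (prefix K a (p + r)) ≡ run (prefix K (a + p) r) → m′ ≡ f n′
      m′≡f[n′] same = Equivalence.to (spec n′ m′) (begin
        accepts (encode3 n′ m′)                           ≡⟨ cong accepts encode3-pumped ⟩
        accepts (prefix K a (p + r) ++ encodeLen r n m)   ≡⟨ accepts-++-cong A (prefix K a (p + r)) (prefix K (a + p) r) (encodeLen r n m) same ⟩
        accepts (prefix K (a + p) r ++ encodeLen r n m)   ≡⟨ cong accepts (encodeLen-+ (a + p) r n m) ⟨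
        accepts (encodeLen K n m)                         ≡⟨ cong accepts (encode3-repunit K m (f[repunit]<3^ K)) ⟨
        accepts (encode3 n m)                             ≡⟨ Equivalence.from (spec n m) refl ⟩
        true                                              ∎)
        where open ≡-Reasoning

    pumping-fails : ∀ a p r → 0 < p → p < 3 ^ r →
                    run (prefix (a + p + r) a (p + r)) ≢ run (prefix (a + p + r) (a + p) r)
    pumping-fails a p r 0<p p<3^r same = >⇒∤ {{>-nonZero 0<p}} p<3^r
      ([m+n]%o≡m%o⇒o∣n z p (3 ^ r) {{3^≢0 r}} (trans z+p≡repunit (sym z≡repunit)))
      where
      open Pumped a p r
      z : ℕ
      z = 2 * (m %3^ r) + (a + r)
      z≡repunit : z %3^ r ≡ repunit r
      z≡repunit = subst (λ y → (2 * y + (a + r)) %3^ r ≡ repunit r) m′%3^r≡m%3^r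
        (twice-%3^-repunit a r m′ (a + r)
          (subst (λ y → 2 * y + (a + r) ≡ n′) (sym (m′≡f[n′] same)) (2f[repunit]+k≡repunit (a + r))))
      z+p≡repunit : (z + p) %3^ r ≡ repunit r
      z+p≡repunit = subst (λ y → y %3^ r ≡ repunit r)
        (solve 4 (λ y a p r → con 2 :* y :+ (a :+ p :+ r) := con 2 :* y :+ (a :+ r) :+ p) refl (m %3^ r) a p r)
        (twice-%3^-repunit (a + p) r m K (2f[repunit]+k≡repunit K))

  not-synchronised : ¬ Synchronised3 f
  not-synchronised (A , spec) =
    let a , p , 0<p , a+p≤N , same = run-collision A (λ t → prefix K t (K ∸ t))
        r : ℕ
        r = K ∸ (a + p)
        a+p+r≡K : a + p + r ≡ K
        a+p+r≡K = m+[n∸m]≡n (≤-trans a+p≤N (m≤m+n N N))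
        K∸a≡p+r : K ∸ a ≡ p + r
        K∸a≡p+r = trans (cong (_∸ a) (trans (sym a+p+r≡K) (+-assoc a p r))) (m+n∸m≡n a (p + r))
        N≤r : N ≤ r
        N≤r = subst (_≤ r) (m+n∸m≡n N N) (∸-monoʳ-≤ K a+p≤N)
        p<3^r : p < 3 ^ r
        p<3^r = ≤-<-trans (≤-trans (≤-trans (m≤n+m p a) a+p≤N) N≤r)
                          (≤-<-trans (k≤repunit r) (repunit<3^ r))
    in pumping-fails A spec a p r 0<p p<3^r
         (subst₂ (λ k q → DFA.run A (prefix k a q) ≡ DFA.run A (prefix k (a + p) r)) (sym a+p+r≡K) K∸a≡p+r same)
    where
    N K : ℕ
    N = DFA.numStates A
    K = N + N

module _ (s : ℕ → ℕ)
         (s[3n]≡0 : ∀ n → s (3 * n) ≡ 0)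
         (s[3n+1]≡s[n] : ∀ n → s (3 * n + 1) ≡ s n)
         (s[3n+2]≡1 : ∀ n → s (3 * n + 2) ≡ 1) where

  private
    S : ℕ → ℕ
    S = runningSum s

  runningSum-3n+1 : ∀ n → S (suc (3 * n)) ≡ S n + n
  runningSum-3n+1 zero    = cong (s 0 +_) (trans (s[3n+1]≡s[n] 0) (s[3n]≡0 0))
  runningSum-3n+1 (suc n) = begin
    S (suc (3 * suc n))                                                ≡⟨ cong (S ∘ suc) (*-suc 3 n) ⟩
    S (suc (3 * n)) + s (2 + 3 * n) + s (3 + 3 * n) + s (4 + 3 * n)   ≡⟨ cong₂ _+_ (cong₂ _+_ (cong₂ _+_
                                                                           (runningSum-3n+1 n) s[2+3n]≡1) s[3+3n]≡0) s[4+3n]≡s[1+n] ⟩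
    S n + n + 1 + 0 + s (suc n)                                        ≡⟨ solve 3 (λ S n t → S :+ n :+ con 1 :+ con 0 :+ t
                                                                                        := S :+ t :+ (con 1 :+ n))
                                                                                 refl (S n) n (s (suc n)) ⟩
    S n + s (suc n) + suc n                                            ∎
    where
    open ≡-Reasoning
    s[2+3n]≡1 : s (2 + 3 * n) ≡ 1
    s[2+3n]≡1 = trans (cong s (+-comm 2 (3 * n))) (s[3n+2]≡1 n)
    s[3+3n]≡0 : s (3 + 3 * n) ≡ 0
    s[3+3n]≡0 = trans (cong s (sym (*-suc 3 n))) (s[3n]≡0 (suc n))
    s[4+3n]≡s[1+n] : s (4 + 3 * n) ≡ s (suc n)
    s[4+3n]≡s[1+n] = trans (cong s (trans (+-comm 1 (3 + 3 * n)) (cong (_+ 1) (sym (*-suc 3 n)))))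
                           (s[3n+1]≡s[n] (suc n))

  2*runningSum[repunit]+k≡repunit : ∀ k → 2 * S (repunit k) + k ≡ repunit k
  2*runningSum[repunit]+k≡repunit zero    = cong (λ t → 2 * t + 0) (s[3n]≡0 0)
  2*runningSum[repunit]+k≡repunit (suc k) = begin
    2 * S (suc (3 * r)) + suc k    ≡⟨ cong (λ t → 2 * t + suc k) (runningSum-3n+1 r) ⟩
    2 * (S r + r) + suc k          ≡⟨ solve 3 (λ S r k → con 2 :* (S :+ r) :+ (con 1 :+ k)
                                                     := con 1 :+ (con 2 :* r :+ (con 2 :* S :+ k)))
                                              refl (S r) r k ⟩
    suc (2 * r + (2 * S r + k))    ≡⟨ cong (λ t → suc (2 * r + t)) (2*runningSum[repunit]+k≡repunit k) ⟩
    suc (2 * r + r)                ≡⟨ cong suc (solve 1 (λ r → con 2 :* r :+ r := con 3 :* r) refl r) ⟩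
    suc (3 * r)                    ∎
    where
    open ≡-Reasoning
    r : ℕ
    r = repunit k

mainTheorem8 : (s : ℕ → ℕ)
    → (∀ n → s (3 * n) ≡ 0)
    → (∀ n → s (3 * n + 1) ≡ s n)
    → (∀ n → s (3 * n + 2) ≡ 1)
    → ¬ Synchronised3 (runningSum s)
mainTheorem8 s s[3n]≡0 s[3n+1]≡s[n] s[3n+2]≡1 =
  not-synchronised (runningSum s) (2*runningSum[repunit]+k≡repunit s s[3n]≡0 s[3n+1]≡s[n] s[3n+2]≡1)
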